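{- The character of $\Lambda^4\mathrm{Sym}^r\mathbb{C}^2$ satisfies the recursion \[ \begin{bmatrix} r+1 \\ 4\end{bmatrix} = \left(\begin{bmatrix} r \\ 4\end{bmatrix}\right)_{+4} + \sum_{k\ge0} \begin{bmatrix} r-6k-1-3\delta_{r~\text{even}} \\ 2\end{bmatrix} + \sum_{k\ge0} \left(\begin{bmatrix} r-6k-4-3\delta_{r~\text{odd}} \\ 2\end{bmatrix}\right)_{+6}. \]
   Context: Throughout, $\mathfrak{sl}_2$ acts on $\mathbb{C}^2$ and characters are specialised at $(x,y)=(q^{ -1/2},q^{1/2})$. The centred $q$-integer is $[k]=\frac{q^{k/2}-q^{ -k/2}}{q^{1/2}-q^{ -1/2}} = q^{ -(k-1)/2}+\cdots+q^{(k-1)/2}$, the character of $\mathrm{Sym}^{k-1}\mathbb{C}^2$. The centred $q$-binomial is $\begin{bmatrix} r+1 \\ n\end{bmatrix} = \frac{[r+1][r]\cdots[r-n+2]}{[n][n-1]\cdots[1]}$, which equals the plethysm $s_{(1^n)}\circ s_{(r)}(q^{ -1/2},q^{1/2})$, i.e. the character of $\Lambda^n\mathrm{Sym}^r\mathbb{C}^2$ (it is $0$ when the top argument is smaller than $n$). Plus operator: for $f=\sum_i d_i[i]$, define $f_{+j}=\sum_i d_i[i+j]$. $\delta_{r~\text{even}}$ (resp. $\delta_{r~\text{odd}}$) is $1$ if $r$ is even (resp. odd) and $0$ otherwise. -}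

module Defs where

open import Data.Nat as ℕ using (ℕ; zero; suc; _⊔_; _∸_)
open import Data.Integer as ℤ using (ℤ; +_; -[1+_]; ∣_∣; _-_; _+_; _*_)
open import Data.List using (List; []; _∷_; _++_; map; length; filter; foldr; upTo)

-- A (virtual) sl2-character, specialised at (x,y) = (q^{-1/2}, q^{1/2}), is a
-- Laurent polynomial in q^{1/2}.  A genuine character is recorded here by its
-- multiset of weights: the weight w ∈ ℤ stands for the monomial q^{w/2}.

sumℤ : List ℤ → ℤ
sumℤ = foldr _+_ (+ 0)

mult : List ℤ → ℤ → ℤ
mult W m = + length (filter (ℤ._≟ m) W)

symWeights : ℕ → List ℤ
symWeights r = map (λ i → + r - + (2 ℕ.* i)) (upTo (suc r))

choose : {A : Set} → ℕ → List A → List (List A)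
choose zero xs = [] ∷ []
choose (suc n) [] = []
choose (suc n) (x ∷ xs) = map (x ∷_) (choose n xs) ++ choose (suc n) xs

lamSymWeights : ℕ → ℕ → List ℤ
lamSymWeights n r = map sumℤ (choose n (symWeights r))

-- centred q-binomial [t ; n] = character of Λ^n Sym^{t-1} ℂ²
-- (zero when t ≤ 0, in particular when t < n)
qbinW : ℤ → ℕ → List ℤ
qbinW (+ suc r) n = lamSymWeights n r
qbinW (+ zero) n = []
qbinW -[1+ _ ] n = []

qbin : ℤ → ℕ → ℤ → ℤ
qbin t n = mult (qbinW t n)

-- centred q-integer [k] = character of Sym^{k-1} ℂ²  ([0] = 0)
qintW : ℕ → List ℤ
qintW zero = []
qintW (suc k) = symWeights k

qint : ℕ → ℤ → ℤ
qint k = mult (qintW k)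

maxAbs : List ℤ → ℕ
maxAbs = foldr (λ w b → ∣ w ∣ ⊔ b) 0

-- Plus operator: if f = Σ_i d_i [i]  (i ≥ 1) then d_i = c_{i-1} - c_{i+1},
-- c_m the coefficient of q^{m/2}; d_i = 0 for i > maxAbs + 1.
-- f_{+j} = Σ_i d_i [i+j], returned as a coefficient function.
plus : ℕ → List ℤ → ℤ → ℤ
plus j W m = sumℤ (map (λ i → (mult W (+ i - + 1) - mult W (+ i + + 1)) * qint (i ℕ.+ j) m)
                       (map suc (upTo (suc (maxAbs W)))))

-- Σ_{k=0}^{r} f k   (used for the sums over k ≥ 0, whose terms vanish for 6k > r)
sumUpTo : ℕ → (ℕ → ℤ) → ℤ
sumUpTo r f = sumℤ (map f (upTo (suc r)))

δeven : ℕ → ℕ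
δeven zero = 1
δeven (suc n) = 1 ∸ δeven n

δodd : ℕ → ℕ
δodd n = 1 ∸ δeven n

-- Both sides are symmetric, finitely supported coefficient functions (virtual sl₂-characters), so they
-- agree once the multiplicities f(x-1) - f(x+1) of the irreducibles [x], x ≥ 1, agree.  By the q-Pascal
-- rule the multiplicity of [x] in [r+1 ; 4] is that of [x-4] in [r ; 4] plus #{j < r : 2r-5-x-6j ∈ 4ℕ},
-- the latter coming from [r ; 3] and [s ; 2].  Splitting j by parity gives two progressions of step 12
-- whose tops r-1-3δ_even and r-4-3δ_odd are both even, so the first only meets x ≡ 1 and the second only
-- x ≡ 3 (mod 4): these are the multiplicities of the two sums.  The plus operators drop two kinds of terms:
-- for x ≤ 4 the index x-4 is reflected ([-y] = -[y]), and for x ≤ 6 the second progression is evaluated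
-- below [1].  These cancel, by an induction on r computing the multiplicities of [1], [2], [3] in [r ; 4].
module Submission where

open import Defs
open import Data.Nat as ℕ using (ℕ; zero; suc; z≤n; s≤s)
import Data.Nat.Properties as ℕP
open import Data.Integer using (ℤ; +_; -[1+_]; _-_; _+_; _*_; -_)
import Data.Integer as ℤ
import Data.Integer.Properties as ℤP
open import Data.Integer.Tactic.RingSolver using (solve-∀)
open import Data.Empty using (⊥-elim)
open import Data.List using (List; []; _∷_; _++_; map; upTo; applyUpTo)
import Data.List.Properties as LP
open import Data.Product using (Σ; _×_; _,_; proj₁; proj₂)
open import Data.Sum using (_⊎_; inj₁; inj₂)
open import Function using (_∘_)
open import Relation.Binary.PropositionalEquality
open import Relation.Nullary using (yes; no)

δ₀ : ℤ → ℤ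
δ₀ (+ zero)  = + 1
δ₀ (+ suc _) = + 0
δ₀ -[1+ _ ]  = + 0

δ₀-≢0 : ∀ {z} → z ≢ + 0 → δ₀ z ≡ + 0
δ₀-≢0 {+ zero}    z≢0 = ⊥-elim (z≢0 refl)
δ₀-≢0 {+ suc _}   _   = refl
δ₀-≢0 { -[1+ _ ]} _   = refl

δ₀-neg : ∀ z → δ₀ (- z) ≡ δ₀ z
δ₀-neg (+ zero)  = refl
δ₀-neg (+ suc _) = refl
δ₀-neg -[1+ _ ]  = refl

mult-∷ : ∀ x xs m → mult (x ∷ xs) m ≡ δ₀ (m - x) + mult xs m
mult-∷ x xs m with x ℤ.≟ m
... | yes refl rewrite ℤP.+-inverseʳ x = refl
... | no x≢m = sym (trans (cong (_+ mult xs m) (δ₀-≢0 (x≢m ∘ sym ∘ ℤP.i-j≡0⇒i≡j m x)))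
                          (ℤP.+-identityˡ _))

mult-++ : ∀ xs ys m → mult (xs ++ ys) m ≡ mult xs m + mult ys m
mult-++ []       ys m = sym (ℤP.+-identityˡ _)
mult-++ (x ∷ xs) ys m = begin
  mult (x ∷ xs ++ ys) m                ≡⟨ mult-∷ x (xs ++ ys) m ⟩
  δ₀ (m - x) + mult (xs ++ ys) m       ≡⟨ cong (λ z → δ₀ (m - x) + z) (mult-++ xs ys m) ⟩
  δ₀ (m - x) + (mult xs m + mult ys m) ≡⟨ sym (ℤP.+-assoc (δ₀ (m - x)) _ _) ⟩
  δ₀ (m - x) + mult xs m + mult ys m   ≡⟨ cong (_+ mult ys m) (sym (mult-∷ x xs m)) ⟩
  mult (x ∷ xs) m + mult ys m          ∎
  where open ≡-Reasoning

mult-translate : ∀ {f : ℤ → ℤ} c → (∀ x → f x ≡ x + c) →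
                 ∀ xs m → mult (map f xs) m ≡ mult xs (m - c)
mult-translate c f≡+c []       m = refl
mult-translate {f} c f≡+c (x ∷ xs) m = begin
  mult (f x ∷ map f xs) m            ≡⟨ mult-∷ (f x) (map f xs) m ⟩
  δ₀ (m - f x) + mult (map f xs) m   ≡⟨ cong₂ (λ y z → δ₀ y + z)
                                          (trans (cong (λ y → m - y) (f≡+c x)) (shuffle m x c))
                                          (mult-translate c f≡+c xs m) ⟩
  δ₀ (m - c - x) + mult xs (m - c)   ≡⟨ sym (mult-∷ x xs (m - c)) ⟩
  mult (x ∷ xs) (m - c)              ∎
  where
  open ≡-Reasoning
  shuffle : ∀ m x c → m - (x + c) ≡ m - c - x
  shuffle = solve-∀

mult-vanishes : ∀ W x → maxAbs W ℕ.< x → mult W (+ x) ≡ + 0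
mult-vanishes []      x _ = refl
mult-vanishes (w ∷ W) x maxAbs<x = begin
  mult (w ∷ W) (+ x)            ≡⟨ mult-∷ w W (+ x) ⟩
  δ₀ (+ x - w) + mult W (+ x)   ≡⟨ cong₂ _+_ (δ₀-≢0 x≢w)
                                           (mult-vanishes W x (ℕP.≤-trans (s≤s (ℕP.m≤n⊔m _ _)) maxAbs<x)) ⟩
  + 0                           ∎
  where
  open ≡-Reasoning
  x≢w : + x - w ≢ + 0
  x≢w x-w≡0 = ℕP.<-irrefl (cong ℤ.∣_∣ (sym (ℤP.i-j≡0⇒i≡j (+ x) w x-w≡0)))
                          (ℕP.≤-trans (s≤s (ℕP.m≤m⊔n _ _)) maxAbs<x)

subsetSums : ℕ → List ℤ → List ℤ
subsetSums n xs = map sumℤ (choose n xs)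

mult-subsetSums-zero : ∀ xs m → mult (subsetSums 0 xs) m ≡ δ₀ m
mult-subsetSums-zero xs m = trans (mult-∷ (+ 0) [] m) (trans (ℤP.+-identityʳ _) (cong δ₀ (ℤP.+-identityʳ m)))

mult-subsetSums-∷ : ∀ n x xs m → mult (subsetSums (suc n) (x ∷ xs)) m
                                ≡ mult (subsetSums n xs) (m - x) + mult (subsetSums (suc n) xs) m
mult-subsetSums-∷ n x xs m = begin
  mult (map sumℤ (map (x ∷_) (choose n xs) ++ choose (suc n) xs)) m
    ≡⟨ cong (λ l → mult l m) (LP.map-++ sumℤ (map (x ∷_) (choose n xs)) (choose (suc n) xs)) ⟩
  mult (map sumℤ (map (x ∷_) (choose n xs)) ++ subsetSums (suc n) xs) m
    ≡⟨ mult-++ (map sumℤ (map (x ∷_) (choose n xs))) (subsetSums (suc n) xs) m ⟩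
  mult (map sumℤ (map (x ∷_) (choose n xs))) m + mult (subsetSums (suc n) xs) m
    ≡⟨ cong (λ l → mult l m + rest) (sym (LP.map-∘ (choose n xs))) ⟩
  mult (map (sumℤ ∘ (x ∷_)) (choose n xs)) m + mult (subsetSums (suc n) xs) m
    ≡⟨ cong (λ l → mult l m + rest) (LP.map-∘ (choose n xs)) ⟩
  mult (map (λ y → x + y) (subsetSums n xs)) m + mult (subsetSums (suc n) xs) m
    ≡⟨ cong (_+ rest) (mult-translate x (λ y → ℤP.+-comm x y) (subsetSums n xs) m) ⟩
  mult (subsetSums n xs) (m - x) + mult (subsetSums (suc n) xs) m
    ∎
  where
  open ≡-Reasoning
  rest = mult (subsetSums (suc n) xs) m

mult-subsetSums-translate : ∀ {f : ℤ → ℤ} c → (∀ x → f x ≡ x + c) →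
  ∀ n xs m → mult (subsetSums n (map f xs)) m ≡ mult (subsetSums n xs) (m - + n * c)
mult-subsetSums-translate {f} c f≡+c zero xs m = begin
  mult (subsetSums 0 (map f xs)) m ≡⟨ mult-subsetSums-zero (map f xs) m ⟩
  δ₀ m                             ≡⟨ cong δ₀ (e m c) ⟩
  δ₀ (m - + 0 * c)                 ≡⟨ sym (mult-subsetSums-zero xs (m - + 0 * c)) ⟩
  mult (subsetSums 0 xs) (m - + 0 * c) ∎
  where
  open ≡-Reasoning
  e : ∀ m c → m ≡ m - + 0 * c
  e = solve-∀
mult-subsetSums-translate c f≡+c (suc n) []       m = refl
mult-subsetSums-translate {f} c f≡+c (suc n) (x ∷ xs) m = begin
  mult (subsetSums (suc n) (f x ∷ map f xs)) m
    ≡⟨ mult-subsetSums-∷ n (f x) (map f xs) m ⟩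
  mult (subsetSums n (map f xs)) (m - f x) + mult (subsetSums (suc n) (map f xs)) m
    ≡⟨ cong₂ _+_ (mult-subsetSums-translate c f≡+c n xs (m - f x))
                 (mult-subsetSums-translate c f≡+c (suc n) xs m) ⟩
  mult (subsetSums n xs) (m - f x - + n * c) + mult (subsetSums (suc n) xs) (m - + suc n * c)
    ≡⟨ cong (λ y → mult (subsetSums n xs) y + mult (subsetSums (suc n) xs) (m - + suc n * c))
            (trans (cong (λ y → m - y - + n * c) (f≡+c x)) (e m x c (+ n))) ⟩
  mult (subsetSums n xs) (m - + suc n * c - x) + mult (subsetSums (suc n) xs) (m - + suc n * c)
    ≡⟨ sym (mult-subsetSums-∷ n x xs (m - + suc n * c)) ⟩
  mult (subsetSums (suc n) (x ∷ xs)) (m - + suc n * c)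
    ∎
  where
  open ≡-Reasoning
  e : ∀ m x c n → m - (x + c) - n * c ≡ m - (+ 1 + n) * c - x
  e = solve-∀

-- gauss n L m is the coefficient of q^{m/2} in [L ; n]; the recursion is the q-Pascal rule
-- [L+1 ; n+1] = q^{(L-n)/2} [L ; n] + q^{-(n+1)/2} [L ; n+1].
gauss : ℕ → ℕ → ℤ → ℤ
gauss zero    L       m = δ₀ m
gauss (suc n) zero    m = + 0
gauss (suc n) (suc L) m = gauss n L (m + (+ n - + L)) + gauss (suc n) L (m + + suc n)

symWeights-suc : ∀ r → symWeights (suc r) ≡ + suc r ∷ map (λ x → x - + 1) (symWeights r)
symWeights-suc r = begin
  weight (suc r) 0 ∷ map (weight (suc r)) (applyUpTo suc (suc r))
    ≡⟨ cong₂ _∷_ (ℤP.+-identityʳ (+ suc r)) (cong (map (weight (suc r))) (sym (LP.map-upTo suc (suc r)))) ⟩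
  + suc r ∷ map (weight (suc r)) (map suc (upTo (suc r)))
    ≡⟨ cong (+ suc r ∷_) (sym (LP.map-∘ (upTo (suc r)))) ⟩
  + suc r ∷ map (weight (suc r) ∘ suc) (upTo (suc r))
    ≡⟨ cong (+ suc r ∷_) (LP.map-cong weight-suc (upTo (suc r))) ⟩
  + suc r ∷ map ((λ x → x - + 1) ∘ weight r) (upTo (suc r))
    ≡⟨ cong (+ suc r ∷_) (LP.map-∘ (upTo (suc r))) ⟩
  + suc r ∷ map (λ x → x - + 1) (symWeights r)
    ∎
  where
  open ≡-Reasoning
  weight : ℕ → ℕ → ℤ
  weight r i = + r - + (2 ℕ.* i)
  e : ∀ r k → + 1 + r - (+ 2 + k) ≡ r - k - + 1
  e = solve-∀
  weight-suc : ∀ i → weight (suc r) (suc i) ≡ weight r i - + 1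
  weight-suc i = trans (cong (λ k → + suc r - + k) (ℕP.*-suc 2 i)) (e (+ r) (+ (2 ℕ.* i)))

mult-lamSymWeights : ∀ n r m → mult (lamSymWeights n r) m ≡ gauss n (suc r) m
mult-lamSymWeights zero          r       m = mult-subsetSums-zero (symWeights r) m
mult-lamSymWeights (suc zero)    zero    m = trans (mult-subsetSums-∷ 0 (+ 0) [] m)
                                                   (cong (_+ + 0) (mult-subsetSums-zero [] (m - + 0)))
mult-lamSymWeights (suc (suc n)) zero    m = refl
mult-lamSymWeights (suc n)       (suc r) m = begin
  mult (subsetSums (suc n) (symWeights (suc r))) m
    ≡⟨ cong (λ ws → mult (subsetSums (suc n) ws) m) (symWeights-suc r) ⟩
  mult (subsetSums (suc n) (+ suc r ∷ map pred (symWeights r))) m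
    ≡⟨ mult-subsetSums-∷ n (+ suc r) (map pred (symWeights r)) m ⟩
  mult (subsetSums n (map pred (symWeights r))) (m - + suc r)
    + mult (subsetSums (suc n) (map pred (symWeights r))) m
    ≡⟨ cong₂ _+_ (mult-subsetSums-translate (- + 1) (λ _ → refl) n (symWeights r) (m - + suc r))
                 (mult-subsetSums-translate (- + 1) (λ _ → refl) (suc n) (symWeights r) m) ⟩
  mult (lamSymWeights n r) (m - + suc r - + n * - + 1)
    + mult (lamSymWeights (suc n) r) (m - + suc n * - + 1)
    ≡⟨ cong₂ _+_ (trans (cong (mult (lamSymWeights n r)) (e₁ m (+ r) (+ n))) (mult-lamSymWeights n r _))
                 (trans (cong (mult (lamSymWeights (suc n) r)) (e₂ m (+ n))) (mult-lamSymWeights (suc n) r _)) ⟩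
  gauss (suc n) (suc (suc r)) m
    ∎
  where
  open ≡-Reasoning
  pred : ℤ → ℤ
  pred x = x - + 1
  e₁ : ∀ m r n → m - (+ 1 + r) - n * - + 1 ≡ m + (n - (+ 1 + r))
  e₁ = solve-∀
  e₂ : ∀ m n → m - (+ 1 + n) * - + 1 ≡ m + (+ 1 + n)
  e₂ = solve-∀

gauss-pascal′ : ∀ n L m →
  gauss (suc n) (suc L) m ≡ gauss n L (m + (+ L - + n)) + gauss (suc n) L (m - + suc n)
gauss-pascal′ zero    zero    m = refl
gauss-pascal′ (suc n) zero    m = refl
gauss-pascal′ zero    (suc L) m = begin
  δ₀ (m + (+ 0 - + suc L)) + gauss 1 (suc L) (m + + 1)
    ≡⟨ cong (λ x → δ₀ (m + (+ 0 - + suc L)) + x) (gauss-pascal′ 0 L (m + + 1)) ⟩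
  δ₀ (m + (+ 0 - + suc L)) + (δ₀ (m + + 1 + (+ L - + 0)) + gauss 1 L (m + + 1 - + 1))
    ≡⟨ cong₂ (λ x y → δ₀ x + (δ₀ y + gauss 1 L (m + + 1 - + 1))) (e₁ m (+ L)) (e₂ m (+ L)) ⟩
  δ₀ (m - + 1 + (+ 0 - + L)) + (δ₀ (m + (+ suc L - + 0)) + gauss 1 L (m + + 1 - + 1))
    ≡⟨ cong (λ x → δ₀ (m - + 1 + (+ 0 - + L)) + (δ₀ (m + (+ suc L - + 0)) + gauss 1 L x)) (e₃ m) ⟩
  δ₀ (m - + 1 + (+ 0 - + L)) + (δ₀ (m + (+ suc L - + 0)) + gauss 1 L (m - + 1 + + 1))
    ≡⟨ e₄ (δ₀ (m - + 1 + (+ 0 - + L))) (δ₀ (m + (+ suc L - + 0))) (gauss 1 L (m - + 1 + + 1)) ⟩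
  δ₀ (m + (+ suc L - + 0)) + gauss 1 (suc L) (m - + 1)
    ∎
  where
  open ≡-Reasoning
  e₁ : ∀ m L → m + (+ 0 - (+ 1 + L)) ≡ m - + 1 + (+ 0 - L)
  e₁ = solve-∀
  e₂ : ∀ m L → m + + 1 + (L - + 0) ≡ m + ((+ 1 + L) - + 0)
  e₂ = solve-∀
  e₃ : ∀ m → m + + 1 - + 1 ≡ m - + 1 + + 1
  e₃ = solve-∀
  e₄ : ∀ a b c → a + (b + c) ≡ b + (a + c)
  e₄ = solve-∀
gauss-pascal′ (suc n) (suc L) m = begin
  gauss (suc n) (suc L) (m + (+ suc n - + suc L)) + gauss (suc (suc n)) (suc L) (m + + suc (suc n))
    ≡⟨ cong₂ _+_ (gauss-pascal′ n L (m + (+ suc n - + suc L))) (gauss-pascal′ (suc n) L (m + + suc (suc n))) ⟩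
  (G₀ (m + (+ suc n - + suc L) + (+ L - + n)) + G₁ (m + (+ suc n - + suc L) - + suc n))
    + (G₁ (m + + suc (suc n) + (+ L - + suc n)) + G₂ (m + + suc (suc n) - + suc (suc n)))
    ≡⟨ cong₂ _+_ (cong₂ _+_ (cong G₀ (a₁ m (+ n) (+ L))) (cong G₁ (a₂ m (+ n) (+ L))))
                 (cong₂ _+_ (cong G₁ (a₃ m (+ n) (+ L))) (cong G₂ (a₄ m (+ n)))) ⟩
  (G₀ (m + (+ suc L - + suc n) + (+ n - + L)) + G₁ (m - + suc (suc n) + (+ suc n - + L)))
    + (G₁ (m + (+ suc L - + suc n) + + suc n) + G₂ (m - + suc (suc n) + + suc (suc n)))
    ≡⟨ swap (G₀ (m + (+ suc L - + suc n) + (+ n - + L))) (G₁ (m - + suc (suc n) + (+ suc n - + L)))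
            (G₁ (m + (+ suc L - + suc n) + + suc n)) (G₂ (m - + suc (suc n) + + suc (suc n))) ⟩
  gauss (suc n) (suc L) (m + (+ suc L - + suc n)) + gauss (suc (suc n)) (suc L) (m - + suc (suc n))
    ∎
  where
  open ≡-Reasoning
  G₀ G₁ G₂ : ℤ → ℤ
  G₀ = gauss n L
  G₁ = gauss (suc n) L
  G₂ = gauss (suc (suc n)) L
  a₁ : ∀ m n L → m + (+ 1 + n - (+ 1 + L)) + (L - n) ≡ m + (+ 1 + L - (+ 1 + n)) + (n - L)
  a₁ = solve-∀
  a₂ : ∀ m n L → m + (+ 1 + n - (+ 1 + L)) - (+ 1 + n) ≡ m - (+ 2 + n) + (+ 1 + n - L)
  a₂ = solve-∀
  a₃ : ∀ m n L → m + (+ 2 + n) + (L - (+ 1 + n)) ≡ m + (+ 1 + L - (+ 1 + n)) + (+ 1 + n)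
  a₃ = solve-∀
  a₄ : ∀ m n → m + (+ 2 + n) - (+ 2 + n) ≡ m - (+ 2 + n) + (+ 2 + n)
  a₄ = solve-∀
  swap : ∀ a b c d → (a + b) + (c + d) ≡ (a + c) + (b + d)
  swap = solve-∀

gauss-symmetric : ∀ n L m → gauss n L (- m) ≡ gauss n L m
gauss-symmetric zero    L       m = δ₀-neg m
gauss-symmetric (suc n) zero    m = refl
gauss-symmetric (suc n) (suc L) m = begin
  gauss n L (- m + (+ n - + L)) + gauss (suc n) L (- m + + suc n)
    ≡⟨ cong₂ _+_ (cong (gauss n L) (e₁ m (+ n) (+ L))) (cong (gauss (suc n) L) (e₂ m (+ suc n))) ⟩
  gauss n L (- (m + (+ L - + n))) + gauss (suc n) L (- (m - + suc n))
    ≡⟨ cong₂ _+_ (gauss-symmetric n L (m + (+ L - + n))) (gauss-symmetric (suc n) L (m - + suc n)) ⟩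
  gauss n L (m + (+ L - + n)) + gauss (suc n) L (m - + suc n)
    ≡⟨ sym (gauss-pascal′ n L m) ⟩
  gauss (suc n) (suc L) m
    ∎
  where
  open ≡-Reasoning
  e₁ : ∀ m n L → - m + (n - L) ≡ - (m + (L - n))
  e₁ = solve-∀
  e₂ : ∀ m n → - m + n ≡ - (m - n)
  e₂ = solve-∀

mult-subsetSums-one : ∀ xs m → mult (subsetSums 1 xs) m ≡ mult xs m
mult-subsetSums-one []       m = refl
mult-subsetSums-one (x ∷ xs) m = begin
  mult (subsetSums 1 (x ∷ xs)) m                        ≡⟨ mult-subsetSums-∷ 0 x xs m ⟩
  mult (subsetSums 0 xs) (m - x) + mult (subsetSums 1 xs) m
    ≡⟨ cong₂ _+_ (mult-subsetSums-zero xs (m - x)) (mult-subsetSums-one xs m) ⟩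
  δ₀ (m - x) + mult xs m                                ≡⟨ sym (mult-∷ x xs m) ⟩
  mult (x ∷ xs) m                                       ∎
  where open ≡-Reasoning

qbin-+ : ∀ L n m → qbin (+ L) (suc n) m ≡ gauss (suc n) L m
qbin-+ zero    n m = refl
qbin-+ (suc r) n m = mult-lamSymWeights (suc n) r m

qint-gauss : ∀ k m → qint k m ≡ gauss 1 k m
qint-gauss zero    m = refl
qint-gauss (suc k) m = trans (sym (mult-subsetSums-one (symWeights k) m)) (mult-lamSymWeights 1 k m)

∂ : (ℤ → ℤ) → ℤ → ℤ
∂ f x = f (x - + 1) - f (x + + 1)

-- For a virtual character f = Σ_k d_k [k] this is d_{u+1}, the multiplicity of Sym^u ℂ².
multiplicity : (ℤ → ℤ) → ℕ → ℤ
multiplicity f u = ∂ f (+ suc u)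

∂-cong : ∀ {f g : ℤ → ℤ} → (∀ m → f m ≡ g m) → ∀ x → ∂ f x ≡ ∂ g x
∂-cong f≗g x = cong₂ _-_ (f≗g (x - + 1)) (f≗g (x + + 1))

∂-+ : ∀ (f g : ℤ → ℤ) x → ∂ (λ m → f m + g m) x ≡ ∂ f x + ∂ g x
∂-+ f g x = e (f (x - + 1)) (g (x - + 1)) (f (x + + 1)) (g (x + + 1))
  where
  e : ∀ a b c d → a + b - (c + d) ≡ a - c + (b - d)
  e = solve-∀

∂-scale : ∀ c (f : ℤ → ℤ) x → ∂ (λ m → c * f m) x ≡ c * ∂ f x
∂-scale c f x = e c (f (x - + 1)) (f (x + + 1))
  where
  e : ∀ c a b → c * a - c * b ≡ c * (a - b)
  e = solve-∀

∂-sum : ∀ {A : Set} (F : A → ℤ → ℤ) xs x →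
        ∂ (λ m → sumℤ (map (λ i → F i m) xs)) x ≡ sumℤ (map (λ i → ∂ (F i) x) xs)
∂-sum F []       x = refl
∂-sum F (i ∷ xs) x = trans (∂-+ (F i) (λ m → sumℤ (map (λ i → F i m) xs)) x)
                           (cong (λ s → ∂ (F i) x + s) (∂-sum F xs x))

∂-split : ∀ {f g h : ℤ → ℤ} c d → (∀ m → f m ≡ g (m + c) + h (m + d)) →
          ∀ x → ∂ f x ≡ ∂ g (x + c) + ∂ h (x + d)
∂-split {f} {g} {h} c d f≡ x = begin
  f (x - + 1) - f (x + + 1)
    ≡⟨ cong₂ _-_ (f≡ (x - + 1)) (f≡ (x + + 1)) ⟩
  g (x - + 1 + c) + h (x - + 1 + d) - (g (x + + 1 + c) + h (x + + 1 + d))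
    ≡⟨ cong₂ _-_ (cong₂ (λ y z → g y + h z) (e₁ x c) (e₁ x d))
                 (cong₂ (λ y z → g y + h z) (e₂ x c) (e₂ x d)) ⟩
  g (x + c - + 1) + h (x + d - + 1) - (g (x + c + + 1) + h (x + d + + 1))
    ≡⟨ e₃ (g (x + c - + 1)) (h (x + d - + 1)) (g (x + c + + 1)) (h (x + d + + 1)) ⟩
  ∂ g (x + c) + ∂ h (x + d)
    ∎
  where
  open ≡-Reasoning
  e₁ : ∀ x c → x - + 1 + c ≡ x + c - + 1
  e₁ = solve-∀
  e₂ : ∀ x c → x + + 1 + c ≡ x + c + + 1
  e₂ = solve-∀
  e₃ : ∀ a b c d → a + b - (c + d) ≡ a - c + (b - d)
  e₃ = solve-∀

∂-odd : ∀ (f : ℤ → ℤ) → (∀ m → f (- m) ≡ f m) → ∀ x → ∂ f (- x) ≡ - ∂ f x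
∂-odd f f-sym x = begin
  f (- x - + 1) - f (- x + + 1)         ≡⟨ cong₂ (λ y z → f y - f z) (e₁ x) (e₂ x) ⟩
  f (- (x + + 1)) - f (- (x - + 1))     ≡⟨ cong₂ _-_ (f-sym (x + + 1)) (f-sym (x - + 1)) ⟩
  f (x + + 1) - f (x - + 1)             ≡⟨ e₃ (f (x + + 1)) (f (x - + 1)) ⟩
  - (f (x - + 1) - f (x + + 1))         ∎
  where
  open ≡-Reasoning
  e₁ : ∀ x → - x - + 1 ≡ - (x + + 1)
  e₁ = solve-∀
  e₂ : ∀ x → - x + + 1 ≡ - (x - + 1)
  e₂ = solve-∀
  e₃ : ∀ a b → a - b ≡ - (b - a)
  e₃ = solve-∀

record IsVirtualCharacter (f : ℤ → ℤ) : Set where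
  field
    symmetric : ∀ m → f (- m) ≡ f m
    bound     : ℕ
    vanishes  : ∀ x → bound ℕ.≤ x → f (+ x) ≡ + 0

open IsVirtualCharacter

isVC-+ : ∀ {f g : ℤ → ℤ} → IsVirtualCharacter f → IsVirtualCharacter g →
         IsVirtualCharacter (λ m → f m + g m)
isVC-+ F G = record
  { symmetric = λ m → cong₂ _+_ (symmetric F m) (symmetric G m)
  ; bound     = bound F ℕ.⊔ bound G
  ; vanishes  = λ x ⊔≤x → cong₂ _+_ (vanishes F x (ℕP.≤-trans (ℕP.m≤m⊔n _ _) ⊔≤x))
                                    (vanishes G x (ℕP.≤-trans (ℕP.m≤n⊔m _ _) ⊔≤x))
  }

isVC-scale : ∀ c {f : ℤ → ℤ} → IsVirtualCharacter f → IsVirtualCharacter (λ m → c * f m)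
isVC-scale c F = record
  { symmetric = λ m → cong (c *_) (symmetric F m)
  ; bound     = bound F
  ; vanishes  = λ x b≤x → trans (cong (c *_) (vanishes F x b≤x)) (ℤP.*-zeroʳ c)
  }

isVC-sum : ∀ {A : Set} (F : A → ℤ → ℤ) xs → (∀ i → IsVirtualCharacter (F i)) →
           IsVirtualCharacter (λ m → sumℤ (map (λ i → F i m) xs))
isVC-sum F []       _    = record { symmetric = λ _ → refl ; bound = 0 ; vanishes = λ _ _ → refl }
isVC-sum F (i ∷ xs) F-vc = isVC-+ (F-vc i) (isVC-sum F xs F-vc)

isVC-qbin : ∀ t n → IsVirtualCharacter (qbin t (suc n))
isVC-qbin t n = record
  { symmetric = qbin-symmetric t
  ; bound     = suc (maxAbs (qbinW t (suc n)))
  ; vanishes  = mult-vanishes (qbinW t (suc n))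
  }
  where
  qbin-symmetric : ∀ t m → qbin t (suc n) (- m) ≡ qbin t (suc n) m
  qbin-symmetric (+ L)    m = trans (qbin-+ L n (- m))
                                    (trans (gauss-symmetric (suc n) L m) (sym (qbin-+ L n m)))
  qbin-symmetric -[1+ _ ] m = refl

isVC-qint : ∀ k → IsVirtualCharacter (qint k)
isVC-qint k = record
  { symmetric = λ m → trans (qint-gauss k (- m)) (trans (gauss-symmetric 1 k m) (sym (qint-gauss k m)))
  ; bound     = suc (maxAbs (qintW k))
  ; vanishes  = mult-vanishes (qintW k)
  }

isVC-plus : ∀ j W → IsVirtualCharacter (plus j W)
isVC-plus j W = isVC-sum (λ i m → ∂ (mult W) (+ i) * qint (i ℕ.+ j) m) (map suc (upTo (suc (maxAbs W))))
                         (λ i → isVC-scale (∂ (mult W) (+ i)) (isVC-qint (i ℕ.+ j)))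

isVC-ext : ∀ {f g : ℤ → ℤ} → IsVirtualCharacter f → IsVirtualCharacter g →
           (∀ u → multiplicity f u ≡ multiplicity g u) → ∀ m → f m ≡ g m
isVC-ext {f} {g} F G same-multiplicities = pointwise
  where
  diff : ℕ → ℤ
  diff x = f (+ x) - g (+ x)

  rearrange : ∀ a b c d → a - b ≡ c - d → a - c ≡ b - d
  rearrange a b c d a-b≡c-d = begin
    a - c                         ≡⟨ e a b c d ⟩
    (a - b) - (c - d) + (b - d)   ≡⟨ cong (λ z → z - (c - d) + (b - d)) a-b≡c-d ⟩
    (c - d) - (c - d) + (b - d)   ≡⟨ cong (_+ (b - d)) (ℤP.+-inverseʳ (c - d)) ⟩
    + 0 + (b - d)                 ≡⟨ ℤP.+-identityˡ (b - d) ⟩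
    b - d                         ∎
    where
    open ≡-Reasoning
    e : ∀ a b c d → a - c ≡ (a - b) - (c - d) + (b - d)
    e = solve-∀

  two-periodic : ∀ x → diff x ≡ diff (suc (suc x))
  two-periodic x = rearrange (f (+ x)) (f (+ suc (suc x))) (g (+ x)) (g (+ suc (suc x)))
    (subst (λ y → f (+ x) - f y ≡ g (+ x) - g y) x+2 (same-multiplicities x))
    where
    x+2 : + suc x + + 1 ≡ + suc (suc x)
    x+2 = cong +_ (ℕP.+-comm (suc x) 1)

  periodic : ∀ k x → diff x ≡ diff (k ℕ.* 2 ℕ.+ x)
  periodic zero    x = refl
  periodic (suc k) x = trans (periodic k x) (two-periodic (k ℕ.* 2 ℕ.+ x))

  K : ℕ
  K = bound F ℕ.⊔ bound G

  K≤ : ∀ x → K ℕ.≤ K ℕ.* 2 ℕ.+ x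
  K≤ x = ℕP.≤-trans (ℕP.m≤m*n K 2) (ℕP.m≤m+n _ x)

  agree : ∀ x → f (+ x) ≡ g (+ x)
  agree x = ℤP.i-j≡0⇒i≡j _ _ (trans (periodic K x) (cong₂ _-_
    (vanishes F _ (ℕP.≤-trans (ℕP.m≤m⊔n _ _) (K≤ x))) (vanishes G _ (ℕP.≤-trans (ℕP.m≤n⊔m _ _) (K≤ x)))))

  pointwise : ∀ m → f m ≡ g m
  pointwise (+ x)    = agree x
  pointwise -[1+ n ] = trans (symmetric F (+ suc n)) (trans (agree (suc n)) (sym (symmetric G (+ suc n))))

∂-gauss₁ : ∀ L x → ∂ (gauss 1 L) x ≡ δ₀ (x - + L) - δ₀ (x + + L)
∂-gauss₁ zero    x = sym (ℤP.+-inverseʳ (δ₀ (x + + 0)))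
∂-gauss₁ (suc L) x = begin
  ∂ (gauss 1 (suc L)) x
    ≡⟨ ∂-split {g = δ₀} {h = gauss 1 L} (+ 0 - + L) (+ 1) (λ _ → refl) x ⟩
  ∂ δ₀ (x + (+ 0 - + L)) + ∂ (gauss 1 L) (x + + 1)
    ≡⟨ cong (λ y → ∂ δ₀ (x + (+ 0 - + L)) + y) (∂-gauss₁ L (x + + 1)) ⟩
  δ₀ (x + (+ 0 - + L) - + 1) - δ₀ (x + (+ 0 - + L) + + 1) + (δ₀ (x + + 1 - + L) - δ₀ (x + + 1 + + L))
    ≡⟨ cong₂ (λ y z → δ₀ y - δ₀ z + (δ₀ (x + + 1 - + L) - δ₀ (x + + 1 + + L)))
             (e₁ x (+ L)) (e₂ x (+ L)) ⟩
  δ₀ (x - + suc L) - δ₀ (x + + 1 - + L) + (δ₀ (x + + 1 - + L) - δ₀ (x + + 1 + + L))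
    ≡⟨ telescope (δ₀ (x - + suc L)) (δ₀ (x + + 1 - + L)) (δ₀ (x + + 1 + + L)) ⟩
  δ₀ (x - + suc L) - δ₀ (x + + 1 + + L)
    ≡⟨ cong (λ y → δ₀ (x - + suc L) - δ₀ y) (e₃ x (+ L)) ⟩
  δ₀ (x - + suc L) - δ₀ (x + + suc L)
    ∎
  where
  open ≡-Reasoning
  e₁ : ∀ x L → x + (+ 0 - L) - + 1 ≡ x - (+ 1 + L)
  e₁ = solve-∀
  e₂ : ∀ x L → x + (+ 0 - L) + + 1 ≡ x + + 1 - L
  e₂ = solve-∀
  e₃ : ∀ x L → x + + 1 + L ≡ x + (+ 1 + L)
  e₃ = solve-∀
  telescope : ∀ a b c → a - b + (b - c) ≡ a - c
  telescope = solve-∀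

∂-qint : ∀ k u → ∂ (qint k) (+ suc u) ≡ δ₀ (+ suc u - + k)
∂-qint k u = begin
  ∂ (qint k) (+ suc u)                            ≡⟨ ∂-cong (qint-gauss k) (+ suc u) ⟩
  ∂ (gauss 1 k) (+ suc u)                         ≡⟨ ∂-gauss₁ k (+ suc u) ⟩
  δ₀ (+ suc u - + k) - δ₀ (+ suc u + + k)         ≡⟨ ℤP.+-identityʳ _ ⟩
  δ₀ (+ suc u - + k)                              ∎
  where open ≡-Reasoning

raise : ℕ → (ℕ → ℤ) → ℕ → ℤ
raise zero    d u       = d u
raise (suc j) d zero    = + 0
raise (suc j) d (suc u) = raise j d u

applyUpTo-cong : ∀ {f g : ℕ → ℤ} → (∀ i → f i ≡ g i) → ∀ N → applyUpTo f N ≡ applyUpTo g N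
applyUpTo-cong f≗g N = trans (sym (LP.map-upTo _ N)) (trans (LP.map-cong f≗g (upTo N)) (LP.map-upTo _ N))

sum-zero : ∀ {A : Set} (f : A → ℤ) xs → (∀ i → f i ≡ + 0) → sumℤ (map f xs) ≡ + 0
sum-zero f []       f≡0 = refl
sum-zero f (x ∷ xs) f≡0 = cong₂ _+_ (f≡0 x) (sum-zero f xs f≡0)

sum-applyUpTo-zero : ∀ (f : ℕ → ℤ) N → (∀ i → f i ≡ + 0) → sumℤ (applyUpTo f N) ≡ + 0
sum-applyUpTo-zero f N f≡0 = trans (cong sumℤ (sym (LP.map-upTo f N))) (sum-zero f (upTo N) f≡0)

sift : ∀ (d : ℕ → ℤ) N u → (∀ v → N ℕ.≤ v → d v ≡ + 0) →
       sumℤ (applyUpTo (λ i → d i * δ₀ (+ u - + i)) N) ≡ d u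
sift d zero    u       d-vanishes = sym (d-vanishes u z≤n)
sift d (suc N) zero    d-vanishes = begin
  d 0 * + 1 + sumℤ (applyUpTo (λ i → d (suc i) * + 0) N)
    ≡⟨ cong₂ _+_ (ℤP.*-identityʳ (d 0)) (sum-applyUpTo-zero _ N (λ i → ℤP.*-zeroʳ (d (suc i)))) ⟩
  d 0 + + 0
    ≡⟨ ℤP.+-identityʳ (d 0) ⟩
  d 0
    ∎
  where open ≡-Reasoning
sift d (suc N) (suc u) d-vanishes = begin
  d 0 * + 0 + sumℤ (applyUpTo (λ i → d (suc i) * δ₀ (+ suc u - + suc i)) N)
    ≡⟨ cong₂ _+_ (ℤP.*-zeroʳ (d 0))
                 (cong sumℤ (applyUpTo-cong (λ i → cong (λ z → d (suc i) * δ₀ z) (e (+ u) (+ i))) N)) ⟩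
  + 0 + sumℤ (applyUpTo (λ i → d (suc i) * δ₀ (+ u - + i)) N)
    ≡⟨ ℤP.+-identityˡ _ ⟩
  sumℤ (applyUpTo (λ i → d (suc i) * δ₀ (+ u - + i)) N)
    ≡⟨ sift (d ∘ suc) N u (λ v N≤v → d-vanishes (suc v) (s≤s N≤v)) ⟩
  d (suc u)
    ∎
  where
  open ≡-Reasoning
  e : ∀ u i → + 1 + u - (+ 1 + i) ≡ u - i
  e = solve-∀

sift-raise : ∀ (d : ℕ → ℤ) N j u → (∀ v → N ℕ.≤ v → d v ≡ + 0) →
             sumℤ (applyUpTo (λ i → d i * δ₀ (+ suc u - + (suc i ℕ.+ j))) N) ≡ raise j d u
sift-raise d N zero    u       d-vanishes =
  trans (cong sumℤ (applyUpTo-cong (λ i → cong (λ z → d i * δ₀ z) (e (+ u) (+ i))) N)) (sift d N u d-vanishes)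
  where
  e : ∀ u i → + 1 + u - (+ 1 + i + + 0) ≡ u - i
  e = solve-∀
sift-raise d N (suc j) zero    d-vanishes =
  sum-applyUpTo-zero _ N (λ i → trans (cong (λ z → d i * δ₀ z) (e (+ i) (+ j))) (ℤP.*-zeroʳ (d i)))
  where
  e : ∀ i j → + 1 - (+ 1 + i + (+ 1 + j)) ≡ - (+ 1 + (i + j))
  e = solve-∀
sift-raise d N (suc j) (suc u) d-vanishes =
  trans (cong sumℤ (applyUpTo-cong (λ i → cong (λ z → d i * δ₀ z) (e (+ u) (+ i) (+ j))) N))
        (sift-raise d N j u d-vanishes)
  where
  e : ∀ u i j → + 1 + (+ 1 + u) - (+ 1 + i + (+ 1 + j)) ≡ + 1 + u - (+ 1 + i + j)
  e = solve-∀

∂-plus : ∀ j W u → multiplicity (plus j W) u ≡ raise j (multiplicity (mult W)) u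
∂-plus j W u = begin
  ∂ (λ m → sumℤ (map (λ i → c i * qint (i ℕ.+ j) m) (map suc (upTo N)))) x
    ≡⟨ ∂-sum (λ i m → c i * qint (i ℕ.+ j) m) (map suc (upTo N)) x ⟩
  sumℤ (map (λ i → ∂ (λ m → c i * qint (i ℕ.+ j) m) x) (map suc (upTo N)))
    ≡⟨ cong sumℤ (LP.map-cong (λ i → trans (∂-scale (c i) (qint (i ℕ.+ j)) x)
                                           (cong (c i *_) (∂-qint (i ℕ.+ j) u)))
                              (map suc (upTo N))) ⟩
  sumℤ (map (λ i → c i * δ₀ (x - + (i ℕ.+ j))) (map suc (upTo N)))
    ≡⟨ cong sumℤ (trans (sym (LP.map-∘ {g = λ i → c i * δ₀ (x - + (i ℕ.+ j))} {f = suc} (upTo N)))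
                        (LP.map-upTo (λ i → c (suc i) * δ₀ (x - + (suc i ℕ.+ j))) N)) ⟩
  sumℤ (applyUpTo (λ i → c (suc i) * δ₀ (x - + (suc i ℕ.+ j))) N)
    ≡⟨ sift-raise (multiplicity (mult W)) N j u beyond-support ⟩
  raise j (multiplicity (mult W)) u
    ∎
  where
  open ≡-Reasoning
  N = suc (maxAbs W)
  x = + suc u
  c : ℕ → ℤ
  c i = ∂ (mult W) (+ i)
  beyond-support : ∀ v → N ℕ.≤ v → multiplicity (mult W) v ≡ + 0
  beyond-support v N≤v = cong₂ _-_ (mult-vanishes W v N≤v)
    (mult-vanishes W (suc v ℕ.+ 1) (ℕP.≤-trans N≤v (ℕP.≤-trans (ℕP.n≤1+n v) (ℕP.m≤m+n (suc v) 1))))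

divisibleBy4 : ℕ → ℤ
divisibleBy4 0                             = + 1
divisibleBy4 1                             = + 0
divisibleBy4 2                             = + 0
divisibleBy4 3                             = + 0
divisibleBy4 (suc (suc (suc (suc n))))     = divisibleBy4 n

in4ℕ : ℤ → ℤ
in4ℕ (+ n)    = divisibleBy4 n
in4ℕ -[1+ _ ] = + 0

in4ℕ-step : ∀ z → in4ℕ z ≡ δ₀ z + in4ℕ (z - + 4)
in4ℕ-step (+ 0)                         = refl
in4ℕ-step (+ 1)                         = refl
in4ℕ-step (+ 2)                         = refl
in4ℕ-step (+ 3)                         = refl
in4ℕ-step (+ suc (suc (suc (suc n))))   = sym (ℤP.+-identityˡ (divisibleBy4 n))
in4ℕ-step -[1+ n ]                      = refl

in4ℕ-odd : ∀ y → in4ℕ (y * + 2 + + 1) ≡ + 0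
in4ℕ-odd (+ n)    = trans (cong (λ z → in4ℕ (z + + 1)) (sym (ℤP.pos-* n 2))) (divisibleBy4-odd n)
  where
  divisibleBy4-odd : ∀ n → divisibleBy4 (n ℕ.* 2 ℕ.+ 1) ≡ + 0
  divisibleBy4-odd 0             = refl
  divisibleBy4-odd 1             = refl
  divisibleBy4-odd (suc (suc n)) = divisibleBy4-odd n
in4ℕ-odd -[1+ n ] = cong in4ℕ (e (+ n))
  where
  e : ∀ n → - (+ 1 + n) * + 2 + + 1 ≡ - (+ 1 + (n + n))
  e = solve-∀

in4ℕ-2mod4 : ∀ y → in4ℕ (y * + 4 + + 2) ≡ + 0
in4ℕ-2mod4 (+ n)    = trans (cong (λ z → in4ℕ (z + + 2)) (sym (ℤP.pos-* n 4))) (divisibleBy4-2mod4 n)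
  where
  divisibleBy4-2mod4 : ∀ n → divisibleBy4 (n ℕ.* 4 ℕ.+ 2) ≡ + 0
  divisibleBy4-2mod4 zero    = refl
  divisibleBy4-2mod4 (suc n) = divisibleBy4-2mod4 n
in4ℕ-2mod4 -[1+ n ] = cong in4ℕ (e (+ n))
  where
  e : ∀ n → - (+ 1 + n) * + 4 + + 2 ≡ - (+ 1 + (n + n + n + n + + 1))
  e = solve-∀

-- Λ² Sym^{s-1} ℂ² = ⊕_{i ≥ 0} Sym^{2s-4-4i} ℂ²
∂-gauss₂ : ∀ s u → multiplicity (gauss 2 s) u ≡ in4ℕ (+ s + + s - + 3 - + suc u)
∂-gauss₂ zero    u = refl
∂-gauss₂ (suc s) u = begin
  ∂ (gauss 2 (suc s)) x
    ≡⟨ ∂-split {g = gauss 1 s} {h = gauss 2 s} (+ 1 - + s) (+ 2) (λ _ → refl) x ⟩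
  ∂ (gauss 1 s) (x + (+ 1 - + s)) + ∂ (gauss 2 s) (x + + 2)
    ≡⟨ cong₂ _+_ (∂-gauss₁ s (x + (+ 1 - + s)))
                 (trans (cong (∂ (gauss 2 s)) (cong +_ (ℕP.+-comm (suc u) 2))) (∂-gauss₂ s (2 ℕ.+ u))) ⟩
  δ₀ (x + (+ 1 - + s) - + s) - δ₀ (x + (+ 1 - + s) + + s) + in4ℕ (+ s + + s - + 3 - + suc (2 ℕ.+ u))
    ≡⟨ cong₂ _+_ (cong₂ (λ y z → δ₀ y - δ₀ z) (e₁ (+ u) (+ s)) (e₂ (+ u) (+ s)))
                 (cong in4ℕ (e₃ (+ u) (+ s))) ⟩
  δ₀ (- T) - + 0 + in4ℕ (T - + 4)
    ≡⟨ cong (_+ in4ℕ (T - + 4)) (trans (ℤP.+-identityʳ (δ₀ (- T))) (δ₀-neg T)) ⟩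
  δ₀ T + in4ℕ (T - + 4)
    ≡⟨ sym (in4ℕ-step T) ⟩
  in4ℕ T
    ∎
  where
  open ≡-Reasoning
  x = + suc u
  T = + suc s + + suc s - + 3 - x
  e₁ : ∀ u s → + 1 + u + (+ 1 - s) - s ≡ - ((+ 1 + s) + (+ 1 + s) - + 3 - (+ 1 + u))
  e₁ = solve-∀
  e₂ : ∀ u s → + 1 + u + (+ 1 - s) + s ≡ + 2 + u
  e₂ = solve-∀
  e₃ : ∀ u s → s + s - + 3 - (+ 1 + (+ 2 + u)) ≡ (+ 1 + s) + (+ 1 + s) - + 3 - (+ 1 + u) - + 4
  e₃ = solve-∀

count4ℕ : ℕ → ℕ → ℤ → ℤ
count4ℕ c zero    z = + 0
count4ℕ c (suc N) z = in4ℕ z + count4ℕ c N (z - + c)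

count4ℕ-negative : ∀ c N n → count4ℕ c N -[1+ n ] ≡ + 0
count4ℕ-negative c zero    n = refl
count4ℕ-negative c (suc N) n =
  cong (λ y → + 0 + y) (trans (cong (count4ℕ c N) (e (+ n) (+ c))) (count4ℕ-negative c N (n ℕ.+ c)))
  where
  e : ∀ n c → - (+ 1 + n) - c ≡ - (+ 1 + (n + c))
  e = solve-∀

count4ℕ-++ : ∀ c M N z → count4ℕ c (M ℕ.+ N) z ≡ count4ℕ c M z + count4ℕ c N (z - + M * + c)
count4ℕ-++ c zero    N z = sym (trans (ℤP.+-identityˡ _) (cong (count4ℕ c N) (e z (+ c))))
  where
  e : ∀ z c → z - + 0 * c ≡ z
  e = solve-∀
count4ℕ-++ c (suc M) N z = begin
  in4ℕ z + count4ℕ c (M ℕ.+ N) (z - + c)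
    ≡⟨ cong (λ y → in4ℕ z + y) (count4ℕ-++ c M N (z - + c)) ⟩
  in4ℕ z + (count4ℕ c M (z - + c) + count4ℕ c N (z - + c - + M * + c))
    ≡⟨ sym (ℤP.+-assoc (in4ℕ z) (count4ℕ c M (z - + c)) (count4ℕ c N (z - + c - + M * + c))) ⟩
  in4ℕ z + count4ℕ c M (z - + c) + count4ℕ c N (z - + c - + M * + c)
    ≡⟨ cong (λ y → in4ℕ z + count4ℕ c M (z - + c) + count4ℕ c N y) (e z (+ c) (+ M)) ⟩
  in4ℕ z + count4ℕ c M (z - + c) + count4ℕ c N (z - + suc M * + c)
    ∎
  where
  open ≡-Reasoning
  e : ∀ z c M → z - c - M * c ≡ z - (+ 1 + M) * c
  e = solve-∀

count4ℕ-interleave : ∀ c N z →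
  count4ℕ c (N ℕ.+ N) z ≡ count4ℕ (c ℕ.+ c) N z + count4ℕ (c ℕ.+ c) N (z - + c)
count4ℕ-interleave c zero    z = refl
count4ℕ-interleave c (suc N) z = begin
  count4ℕ c (suc (N ℕ.+ suc N)) z
    ≡⟨ cong (λ k → count4ℕ c (suc k) z) (ℕP.+-suc N N) ⟩
  in4ℕ z + (in4ℕ (z - + c) + count4ℕ c (N ℕ.+ N) (z - + c - + c))
    ≡⟨ cong (λ y → in4ℕ z + (in4ℕ (z - + c) + y)) (count4ℕ-interleave c N (z - + c - + c)) ⟩
  in4ℕ z + (in4ℕ (z - + c) + (C₂ (z - + c - + c) + C₂ (z - + c - + c - + c)))
    ≡⟨ cong₂ (λ y y′ → in4ℕ z + (in4ℕ (z - + c) + (C₂ y + C₂ y′))) (e₁ z (+ c)) (e₁ (z - + c) (+ c)) ⟩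
  in4ℕ z + (in4ℕ (z - + c) + (C₂ (z - + (c ℕ.+ c)) + C₂ (z - + c - + (c ℕ.+ c))))
    ≡⟨ e₂ (in4ℕ z) (in4ℕ (z - + c)) (C₂ (z - + (c ℕ.+ c))) (C₂ (z - + c - + (c ℕ.+ c))) ⟩
  count4ℕ (c ℕ.+ c) (suc N) z + count4ℕ (c ℕ.+ c) (suc N) (z - + c)
    ∎
  where
  open ≡-Reasoning
  C₂ : ℤ → ℤ
  C₂ = count4ℕ (c ℕ.+ c) N
  e₁ : ∀ z c → z - c - c ≡ z - (c + c)
  e₁ = solve-∀
  e₂ : ∀ a b c d → a + (b + (c + d)) ≡ (a + c) + (b + d)
  e₂ = solve-∀

count4ℕ-odd : ∀ c N y → count4ℕ (c ℕ.* 2) N (y * + 2 + + 1) ≡ + 0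
count4ℕ-odd c zero    y = refl
count4ℕ-odd c (suc N) y = cong₂ _+_ (in4ℕ-odd y)
  (trans (cong (count4ℕ (c ℕ.* 2) N) (trans (cong (λ k → y * + 2 + + 1 - k) (ℤP.pos-* c 2)) (e y (+ c))))
         (count4ℕ-odd c N (y - + c)))
  where
  e : ∀ y c → y * + 2 + + 1 - c * + 2 ≡ (y - c) * + 2 + + 1
  e = solve-∀

count4ℕ-2mod4 : ∀ c N y → count4ℕ (c ℕ.* 4) N (y * + 4 + + 2) ≡ + 0
count4ℕ-2mod4 c zero    y = refl
count4ℕ-2mod4 c (suc N) y = cong₂ _+_ (in4ℕ-2mod4 y)
  (trans (cong (count4ℕ (c ℕ.* 4) N) (trans (cong (λ k → y * + 4 + + 2 - k) (ℤP.pos-* c 4)) (e y (+ c))))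
         (count4ℕ-2mod4 c N (y - + c)))
  where
  e : ∀ y c → y * + 4 + + 2 - c * + 4 ≡ (y - c) * + 4 + + 2
  e = solve-∀

∂-qbin₂ : ∀ a u → multiplicity (qbin a 2) u ≡ in4ℕ (a + a - + 3 - + suc u)
∂-qbin₂ (+ L)    u = trans (∂-cong (qbin-+ L 1) (+ suc u)) (∂-gauss₂ L u)
∂-qbin₂ -[1+ _ ] u = refl

sum-in4ℕ-progression : ∀ c N z → sumℤ (map (λ k → in4ℕ (z - + c * + k)) (upTo N)) ≡ count4ℕ c N z
sum-in4ℕ-progression c N z = trans (cong sumℤ (LP.map-upTo _ N)) (go N z)
  where
  e₀ : ∀ z c → z - c * + 0 ≡ z
  e₀ = solve-∀
  e₁ : ∀ z c k → z - c * (+ 1 + k) ≡ z - c - c * k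
  e₁ = solve-∀
  go : ∀ N z → sumℤ (applyUpTo (λ k → in4ℕ (z - + c * + k)) N) ≡ count4ℕ c N z
  go zero    z = refl
  go (suc N) z = cong₂ _+_ (cong in4ℕ (e₀ z (+ c)))
    (trans (cong sumℤ (applyUpTo-cong (λ k → cong in4ℕ (e₁ z (+ c) (+ k))) N)) (go N (z - + c)))

-- the multiplicity of [x] in Σ_{k ≤ r} [c - 6k ; 2], for x ≥ 1
Λ²-series : ℤ → ℕ → ℤ → ℤ
Λ²-series c r x = count4ℕ 12 (suc r) (c + c - + 3 - x)

∂-Λ²-series : ∀ (a : ℕ → ℤ) r → (∀ k → a k ≡ a 0 - + 6 * + k) →
  ∀ u → multiplicity (λ m → sumUpTo r (λ k → qbin (a k) 2 m)) u ≡ Λ²-series (a 0) r (+ suc u)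
∂-Λ²-series a r a-progression u = begin
  multiplicity (λ m → sumUpTo r (λ k → qbin (a k) 2 m)) u
    ≡⟨ ∂-sum (λ k → qbin (a k) 2) (upTo (suc r)) (+ suc u) ⟩
  sumℤ (map (λ k → multiplicity (qbin (a k) 2) u) (upTo (suc r)))
    ≡⟨ cong sumℤ (LP.map-cong (λ k → trans (∂-qbin₂ (a k) u) (cong in4ℕ (arg k))) (upTo (suc r))) ⟩
  sumℤ (map (λ k → in4ℕ (a 0 + a 0 - + 3 - + suc u - + 12 * + k)) (upTo (suc r)))
    ≡⟨ sum-in4ℕ-progression 12 (suc r) (a 0 + a 0 - + 3 - + suc u) ⟩
  Λ²-series (a 0) r (+ suc u)
    ∎
  where
  open ≡-Reasoning
  e : ∀ a₀ k x → (a₀ - + 6 * k) + (a₀ - + 6 * k) - + 3 - x ≡ a₀ + a₀ - + 3 - x - + 12 * k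
  e = solve-∀
  arg : ∀ k → a k + a k - + 3 - + suc u ≡ a 0 + a 0 - + 3 - + suc u - + 12 * + k
  arg k = trans (cong (λ y → y + y - + 3 - + suc u) (a-progression k)) (e (a 0) (+ k) (+ suc u))

raise-cong : ∀ j {d d′ : ℕ → ℤ} → (∀ v → d v ≡ d′ v) → ∀ u → raise j d u ≡ raise j d′ u
raise-cong zero    d≗d′ u       = d≗d′ u
raise-cong (suc j) d≗d′ zero    = refl
raise-cong (suc j) d≗d′ (suc u) = raise-cong j d≗d′ u

sum-raise : ∀ {A : Set} (d : A → ℕ → ℤ) xs j u →
  sumℤ (map (λ k → raise j (d k) u) xs) ≡ raise j (λ v → sumℤ (map (λ k → d k v) xs)) u
sum-raise d xs zero    u       = refl
sum-raise d xs (suc j) zero    = sum-zero (λ _ → + 0) xs (λ _ → refl)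
sum-raise d xs (suc j) (suc u) = sum-raise d xs j u

∂-plus-Λ²-series : ∀ (b : ℕ → ℤ) r → (∀ k → b k ≡ b 0 - + 6 * + k) → ∀ j u →
  multiplicity (λ m → sumUpTo r (λ k → plus j (qbinW (b k) 2) m)) u
    ≡ raise j (λ v → Λ²-series (b 0) r (+ suc v)) u
∂-plus-Λ²-series b r b-progression j u = begin
  multiplicity (λ m → sumUpTo r (λ k → plus j (qbinW (b k) 2) m)) u
    ≡⟨ ∂-sum (λ k → plus j (qbinW (b k) 2)) (upTo (suc r)) (+ suc u) ⟩
  sumℤ (map (λ k → multiplicity (plus j (qbinW (b k) 2)) u) (upTo (suc r)))
    ≡⟨ cong sumℤ (LP.map-cong (λ k → ∂-plus j (qbinW (b k) 2) u) (upTo (suc r))) ⟩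
  sumℤ (map (λ k → raise j (multiplicity (qbin (b k) 2)) u) (upTo (suc r)))
    ≡⟨ sum-raise (λ k → multiplicity (qbin (b k) 2)) (upTo (suc r)) j u ⟩
  raise j (λ v → sumℤ (map (λ k → multiplicity (qbin (b k) 2) v) (upTo (suc r)))) u
    ≡⟨ raise-cong j (λ v → trans (sym (∂-sum (λ k → qbin (b k) 2) (upTo (suc r)) (+ suc v)))
                                 (∂-Λ²-series b r b-progression v)) u ⟩
  raise j (λ v → Λ²-series (b 0) r (+ suc v)) u
    ∎
  where open ≡-Reasoning

top₁ top₂ : ℕ → ℕ → ℤ
top₁ r k = + r - + (6 ℕ.* k) - + 1 - + (3 ℕ.* δeven r)
top₂ r k = + r - + (6 ℕ.* k) - + 4 - + (3 ℕ.* δodd r)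

top-progression : ∀ r c d k → + r - + (6 ℕ.* k) - c - d ≡ (+ r - + 0 - c - d) - + 6 * + k
top-progression r c d k = trans (cong (λ y → + r - y - c - d) (ℤP.pos-* 6 k)) (e (+ r) c d (+ k))
  where
  e : ∀ r c d k → r - + 6 * k - c - d ≡ (r - + 0 - c - d) - + 6 * k
  e = solve-∀

parity : ∀ r → Σ ℕ λ t → r ≡ t ℕ.+ t ⊎ r ≡ suc (t ℕ.+ t)
parity zero    = 0 , inj₁ refl
parity (suc r) with parity r
... | t , inj₁ r≡2t   = t , inj₂ (cong suc r≡2t)
... | t , inj₂ r≡2t+1 = suc t , inj₁ (trans (cong suc r≡2t+1) (cong suc (sym (ℕP.+-suc t t))))

δeven-even : ∀ t → δeven (t ℕ.+ t) ≡ 1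
δeven-odd  : ∀ t → δeven (suc (t ℕ.+ t)) ≡ 0
δeven-even zero    = refl
δeven-even (suc t) = trans (cong (λ n → 1 ℕ.∸ δeven n) (ℕP.+-suc t t)) (cong (1 ℕ.∸_) (δeven-odd t))
δeven-odd t = cong (1 ℕ.∸_) (δeven-even t)

δeven≤1 : ∀ r → δeven r ℕ.≤ 1
δeven≤1 zero    = s≤s z≤n
δeven≤1 (suc r) = ℕP.m∸n≤m 1 (δeven r)

δodd-suc : ∀ r → δodd (suc r) ≡ δeven r
δodd-suc r = ℕP.m∸[m∸n]≡n (δeven≤1 r)

data TopsParity (r : ℕ) : Set where
  even : ∀ t → + r ≡ + t + + t → top₁ r 0 ≡ + t + + t - + 4 → top₂ r 0 ≡ + t + + t - + 4 → TopsParity r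
  odd  : ∀ t → + r ≡ + t + + t + + 1 → top₁ r 0 ≡ + t + + t → top₂ r 0 ≡ + t + + t - + 6 → TopsParity r

tops-by-parity : ∀ r → TopsParity r
tops-by-parity r with parity r
... | t , inj₁ refl = even t refl
  (trans (cong (λ δ → + (t ℕ.+ t) - + 0 - + 1 - + (3 ℕ.* δ)) (δeven-even t)) (e₁ (+ t)))
  (trans (cong (λ δ → + (t ℕ.+ t) - + 0 - + 4 - + (3 ℕ.* (1 ℕ.∸ δ))) (δeven-even t)) (e₂ (+ t)))
  where
  e₁ : ∀ t → t + t - + 0 - + 1 - + 3 ≡ t + t - + 4
  e₁ = solve-∀
  e₂ : ∀ t → t + t - + 0 - + 4 - + 0 ≡ t + t - + 4
  e₂ = solve-∀
... | t , inj₂ refl = odd t (ℤP.+-comm (+ 1) (+ (t ℕ.+ t)))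
  (trans (cong (λ δ → + suc (t ℕ.+ t) - + 0 - + 1 - + (3 ℕ.* δ)) (δeven-odd t)) (e₁ (+ t)))
  (trans (cong (λ δ → + suc (t ℕ.+ t) - + 0 - + 4 - + (3 ℕ.* (1 ℕ.∸ δ))) (δeven-odd t)) (e₂ (+ t)))
  where
  e₁ : ∀ t → + 1 + (t + t) - + 0 - + 1 - + 0 ≡ t + t
  e₁ = solve-∀
  e₂ : ∀ t → + 1 + (t + t) - + 0 - + 4 - + 3 ≡ t + t - + 6
  e₂ = solve-∀

top₁-even : ∀ r → Σ ℤ λ α → top₁ r 0 ≡ α + α
top₁-even r with tops-by-parity r
... | even t _ a≡ _ = + t - + 2 , trans a≡ (e (+ t))
  where
  e : ∀ t → t + t - + 4 ≡ (t - + 2) + (t - + 2)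
  e = solve-∀
... | odd t _ a≡ _ = + t , a≡

top₂-even : ∀ r → Σ ℤ λ β → top₂ r 0 ≡ β + β
top₂-even r with tops-by-parity r
... | even t _ _ b≡ = + t - + 2 , trans b≡ (e (+ t))
  where
  e : ∀ t → t + t - + 4 ≡ (t - + 2) + (t - + 2)
  e = solve-∀
... | odd t _ _ b≡ = + t - + 3 , trans b≡ (e (+ t))
  where
  e : ∀ t → t + t - + 6 ≡ (t - + 3) + (t - + 3)
  e = solve-∀

Λ²-series-extend : ∀ c r x n → c + c - + 3 - x - + suc r * + 12 ≡ -[1+ n ] →
                   Λ²-series c (suc r) x ≡ Λ²-series c r x
Λ²-series-extend c r x n tail≡ = begin
  count4ℕ 12 (suc (suc r)) z            ≡⟨ cong (λ N → count4ℕ 12 N z) (ℕP.+-comm 1 (suc r)) ⟩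
  count4ℕ 12 (suc r ℕ.+ 1) z            ≡⟨ count4ℕ-++ 12 (suc r) 1 z ⟩
  count4ℕ 12 (suc r) z + count4ℕ 12 1 (z - + suc r * + 12)
                                        ≡⟨ cong (λ y → count4ℕ 12 (suc r) z + count4ℕ 12 1 y) tail≡ ⟩
  count4ℕ 12 (suc r) z + + 0            ≡⟨ ℤP.+-identityʳ _ ⟩
  count4ℕ 12 (suc r) z                  ∎
  where
  open ≡-Reasoning
  z = c + c - + 3 - x

count4ℕ-6-split : ∀ r u → count4ℕ 6 r (+ r + + r - + 5 - + suc u)
  ≡ Λ²-series (top₁ r 0) r (+ suc u) + Λ²-series (top₂ r 0) r (+ suc u - + 6)
count4ℕ-6-split r u = begin
  count4ℕ 6 r Z
    ≡⟨ sym (ℤP.+-identityʳ _) ⟩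
  count4ℕ 6 r Z + + 0
    ≡⟨ cong (λ y → count4ℕ 6 r Z + y)
            (sym (trans (cong (count4ℕ 6 (2 ℕ.+ r)) (tail (+ r) (+ u))) (count4ℕ-negative 6 (2 ℕ.+ r) _))) ⟩
  count4ℕ 6 r Z + count4ℕ 6 (2 ℕ.+ r) (Z - + r * + 6)
    ≡⟨ sym (count4ℕ-++ 6 r (2 ℕ.+ r) Z) ⟩
  count4ℕ 6 (r ℕ.+ (2 ℕ.+ r)) Z
    ≡⟨ cong (λ N → count4ℕ 6 N Z) (ℕP.+-suc r (suc r)) ⟩
  count4ℕ 6 (suc r ℕ.+ suc r) Z
    ≡⟨ count4ℕ-interleave 6 (suc r) Z ⟩
  C Z + C (Z - + 6)
    ≡⟨ by-parity (tops-by-parity r) ⟩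
  Λ²-series (top₁ r 0) r x + Λ²-series (top₂ r 0) r (x - + 6)
    ∎
  where
  open ≡-Reasoning
  x = + suc u
  Z = + r + + r - + 5 - x
  tail : ∀ r u → r + r - + 5 - (+ 1 + u) - r * + 6 ≡ - (+ 1 + (r + r + r + r + + 5 + u))
  tail = solve-∀
  C : ℤ → ℤ
  C = count4ℕ 12 (suc r)
  by-parity : TopsParity r → C Z + C (Z - + 6) ≡ Λ²-series (top₁ r 0) r x + Λ²-series (top₂ r 0) r (x - + 6)
  by-parity (even t r≡ a≡ b≡) = trans (ℤP.+-comm (C Z) (C (Z - + 6))) (cong₂ _+_ (cong C first) (cong C second))
    where
    e₁ : ∀ t x → (t + t) + (t + t) - + 5 - x - + 6 ≡ (t + t - + 4) + (t + t - + 4) - + 3 - x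
    e₁ = solve-∀
    e₂ : ∀ t x → (t + t) + (t + t) - + 5 - x ≡ (t + t - + 4) + (t + t - + 4) - + 3 - (x - + 6)
    e₂ = solve-∀
    first : Z - + 6 ≡ top₁ r 0 + top₁ r 0 - + 3 - x
    first = trans (cong (λ y → y + y - + 5 - x - + 6) r≡)
                  (trans (e₁ (+ t) x) (cong (λ y → y + y - + 3 - x) (sym a≡)))
    second : Z ≡ top₂ r 0 + top₂ r 0 - + 3 - (x - + 6)
    second = trans (cong (λ y → y + y - + 5 - x) r≡)
                   (trans (e₂ (+ t) x) (cong (λ y → y + y - + 3 - (x - + 6)) (sym b≡)))
  by-parity (odd t r≡ a≡ b≡) = cong₂ _+_ (cong C first) (cong C second)
    where
    e₁ : ∀ t x → (t + t + + 1) + (t + t + + 1) - + 5 - x ≡ (t + t) + (t + t) - + 3 - x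
    e₁ = solve-∀
    e₂ : ∀ t x → (t + t + + 1) + (t + t + + 1) - + 5 - x - + 6 ≡ (t + t - + 6) + (t + t - + 6) - + 3 - (x - + 6)
    e₂ = solve-∀
    first : Z ≡ top₁ r 0 + top₁ r 0 - + 3 - x
    first = trans (cong (λ y → y + y - + 5 - x) r≡) (trans (e₁ (+ t) x) (cong (λ y → y + y - + 3 - x) (sym a≡)))
    second : Z - + 6 ≡ top₂ r 0 + top₂ r 0 - + 3 - (x - + 6)
    second = trans (cong (λ y → y + y - + 5 - x - + 6) r≡)
                   (trans (e₂ (+ t) x) (cong (λ y → y + y - + 3 - (x - + 6)) (sym b≡)))

∂-gauss₃ : ∀ r u → ∂ (gauss 3 r) (+ suc u + (+ r - + 3)) ≡ count4ℕ 6 r (+ r + + r - + 5 - + suc u)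
∂-gauss₃ zero    u = refl
∂-gauss₃ (suc r) u = begin
  ∂ (gauss 3 (suc r)) y
    ≡⟨ ∂-split {g = gauss 2 r} {h = gauss 3 r} (+ 2 - + r) (+ 3) (λ _ → refl) y ⟩
  ∂ (gauss 2 r) (y + (+ 2 - + r)) + ∂ (gauss 3 r) (y + + 3)
    ≡⟨ cong₂ _+_ (cong (∂ (gauss 2 r)) (e₁ (+ u) (+ r))) (cong (∂ (gauss 3 r)) (e₂ (+ u) (+ r))) ⟩
  multiplicity (gauss 2 r) u + ∂ (gauss 3 r) (+ suc (u ℕ.+ 4) + (+ r - + 3))
    ≡⟨ cong₂ _+_ (∂-gauss₂ r u) (∂-gauss₃ r (u ℕ.+ 4)) ⟩
  in4ℕ (+ r + + r - + 3 - + suc u) + count4ℕ 6 r (+ r + + r - + 5 - + suc (u ℕ.+ 4))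
    ≡⟨ cong₂ (λ z z′ → in4ℕ z + count4ℕ 6 r z′) (e₃ (+ r) (+ u)) (e₄ (+ r) (+ u)) ⟩
  count4ℕ 6 (suc r) (+ suc r + + suc r - + 5 - + suc u)
    ∎
  where
  open ≡-Reasoning
  y = + suc u + (+ suc r - + 3)
  e₁ : ∀ u r → + 1 + u + (+ 1 + r - + 3) + (+ 2 - r) ≡ + 1 + u
  e₁ = solve-∀
  e₂ : ∀ u r → + 1 + u + (+ 1 + r - + 3) + + 3 ≡ + 1 + (u + + 4) + (r - + 3)
  e₂ = solve-∀
  e₃ : ∀ r u → r + r - + 3 - (+ 1 + u) ≡ (+ 1 + r) + (+ 1 + r) - + 5 - (+ 1 + u)
  e₃ = solve-∀
  e₄ : ∀ r u → r + r - + 5 - (+ 1 + (u + + 4)) ≡ (+ 1 + r) + (+ 1 + r) - + 5 - (+ 1 + u) - + 6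
  e₄ = solve-∀

∂-gauss₄-suc : ∀ r u → multiplicity (gauss 4 (suc r)) u
  ≡ Λ²-series (top₁ r 0) r (+ suc u) + Λ²-series (top₂ r 0) r (+ suc u - + 6) + ∂ (gauss 4 r) (+ suc u - + 4)
∂-gauss₄-suc r u = begin
  ∂ (gauss 4 (suc r)) (+ suc u)
    ≡⟨ ∂-split {g = gauss 3 r} {h = gauss 4 r} (+ r - + 3) (- + 4) (gauss-pascal′ 3 r) (+ suc u) ⟩
  ∂ (gauss 3 r) (+ suc u + (+ r - + 3)) + ∂ (gauss 4 r) (+ suc u - + 4)
    ≡⟨ cong (_+ ∂ (gauss 4 r) (+ suc u - + 4)) (trans (∂-gauss₃ r u) (count4ℕ-6-split r u)) ⟩
  Λ²-series (top₁ r 0) r (+ suc u) + Λ²-series (top₂ r 0) r (+ suc u - + 6) + ∂ (gauss 4 r) (+ suc u - + 4)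
    ∎
  where open ≡-Reasoning

∂-symmetric-at-0 : ∀ (f : ℤ → ℤ) → (∀ m → f (- m) ≡ f m) → ∂ f (+ 0) ≡ + 0
∂-symmetric-at-0 f f-sym = trans (cong (_- f (+ 1)) (f-sym (+ 1))) (ℤP.+-inverseʳ (f (+ 1)))

Λ²-series-odd : ∀ c r x y → c + c - + 3 - x ≡ y * + 2 + + 1 → Λ²-series c r x ≡ + 0
Λ²-series-odd c r x y arg≡ = trans (cong (count4ℕ 12 (suc r)) arg≡) (count4ℕ-odd 6 (suc r) y)

Λ²-series-2mod4 : ∀ c r x y → c + c - + 3 - x ≡ y * + 4 + + 2 → Λ²-series c r x ≡ + 0
Λ²-series-2mod4 c r x y arg≡ = trans (cong (count4ℕ 12 (suc r)) arg≡) (count4ℕ-2mod4 3 (suc r) y)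

record Λ⁴-low-multiplicities (r : ℕ) : Set where
  field
    at-[1] : multiplicity (gauss 4 r) 0 ≡ Λ²-series (top₂ r 0) r (+ 3 - + 6)
    at-[2] : multiplicity (gauss 4 r) 1 ≡ + 0
    at-[3] : multiplicity (gauss 4 r) 2 ≡ + 0

Λ⁴-boundary : ∀ r → Λ⁴-low-multiplicities r → ∀ u →
  Λ²-series (top₂ r 0) r (+ suc u - + 6) + ∂ (gauss 4 r) (+ suc u - + 4)
    ≡ raise 4 (multiplicity (gauss 4 r)) u + raise 6 (λ v → Λ²-series (top₂ r 0) r (+ suc v)) u
Λ⁴-boundary r low = boundary
  where
  open Λ⁴-low-multiplicities low
  b = top₂ r 0
  β = proj₁ (top₂-even r)
  b≡ = proj₂ (top₂-even r)
  ∂-odd₄ : ∀ x → ∂ (gauss 4 r) (- x) ≡ - ∂ (gauss 4 r) x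
  ∂-odd₄ = ∂-odd (gauss 4 r) (gauss-symmetric 4 r)
  b-2mod4 : ∀ x y → (β + β) + (β + β) - + 3 - x ≡ y * + 4 + + 2 → Λ²-series b r x ≡ + 0
  b-2mod4 x y arg≡ = trans (cong (λ c → Λ²-series c r x) b≡) (Λ²-series-2mod4 (β + β) r x y arg≡)
  e₀ : ∀ β → (β + β) + (β + β) - + 3 - (+ 1 - + 6) ≡ β * + 4 + + 2
  e₀ = solve-∀
  e₁ : ∀ b → b + b - + 3 - (+ 2 - + 6) ≡ b * + 2 + + 1
  e₁ = solve-∀
  e₃ : ∀ b → b + b - + 3 - (+ 4 - + 6) ≡ (b - + 1) * + 2 + + 1
  e₃ = solve-∀
  e₄ : ∀ β → (β + β) + (β + β) - + 3 - (+ 5 - + 6) ≡ (β - + 1) * + 4 + + 2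
  e₄ = solve-∀
  e₅ : ∀ b → b + b - + 3 - (+ 6 - + 6) ≡ (b - + 2) * + 2 + + 1
  e₅ = solve-∀
  zero-+ : ∀ {p} a → p ≡ + 0 → p + a ≡ a + + 0
  zero-+ a refl = trans (ℤP.+-identityˡ a) (sym (ℤP.+-identityʳ a))
  boundary : ∀ u → Λ²-series b r (+ suc u - + 6) + ∂ (gauss 4 r) (+ suc u - + 4)
                   ≡ raise 4 (multiplicity (gauss 4 r)) u + raise 6 (λ v → Λ²-series b r (+ suc v)) u
  boundary 0 = cong₂ _+_ (b-2mod4 (+ 1 - + 6) β (e₀ β)) (trans (∂-odd₄ (+ 3)) (cong -_ at-[3]))
  boundary 1 = cong₂ _+_ (Λ²-series-odd b r (+ 2 - + 6) b (e₁ b)) (trans (∂-odd₄ (+ 2)) (cong -_ at-[2]))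
  boundary 2 = trans (cong (λ y → Λ²-series b r (+ 3 - + 6) + y) (trans (∂-odd₄ (+ 1)) (cong -_ at-[1])))
                     (ℤP.+-inverseʳ (Λ²-series b r (+ 3 - + 6)))
  boundary 3 = cong₂ _+_ (Λ²-series-odd b r (+ 4 - + 6) (b - + 1) (e₃ b))
                         (∂-symmetric-at-0 (gauss 4 r) (gauss-symmetric 4 r))
  boundary 4 = zero-+ (∂ (gauss 4 r) (+ 1)) (b-2mod4 (+ 5 - + 6) (β - + 1) (e₄ β))
  boundary 5 = zero-+ (∂ (gauss 4 r) (+ 2)) (Λ²-series-odd b r (+ 6 - + 6) (b - + 2) (e₅ b))
  boundary (suc (suc (suc (suc (suc (suc v)))))) =
    ℤP.+-comm (Λ²-series b r (+ suc v)) (multiplicity (gauss 4 r) (2 ℕ.+ v))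

Λ⁴-multiplicity-from-low : ∀ r → Λ⁴-low-multiplicities r → ∀ u →
  multiplicity (gauss 4 (suc r)) u
    ≡ raise 4 (multiplicity (gauss 4 r)) u + Λ²-series (top₁ r 0) r (+ suc u)
      + raise 6 (λ v → Λ²-series (top₂ r 0) r (+ suc v)) u
Λ⁴-multiplicity-from-low r low u = begin
  multiplicity (gauss 4 (suc r)) u     ≡⟨ ∂-gauss₄-suc r u ⟩
  A + B + C                            ≡⟨ ℤP.+-assoc A B C ⟩
  A + (B + C)                          ≡⟨ cong (λ y → A + y) (Λ⁴-boundary r low u) ⟩
  A + (R₄ + R₆)                        ≡⟨ e A R₄ R₆ ⟩
  R₄ + A + R₆                          ∎
  where
  open ≡-Reasoning
  A = Λ²-series (top₁ r 0) r (+ suc u)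
  B = Λ²-series (top₂ r 0) r (+ suc u - + 6)
  C = ∂ (gauss 4 r) (+ suc u - + 4)
  R₄ = raise 4 (multiplicity (gauss 4 r)) u
  R₆ = raise 6 (λ v → Λ²-series (top₂ r 0) r (+ suc v)) u
  e : ∀ a b c → a + (b + c) ≡ b + a + c
  e = solve-∀

Λ⁴-low : ∀ r → Λ⁴-low-multiplicities r
Λ⁴-low zero    = record { at-[1] = refl ; at-[2] = refl ; at-[3] = refl }
Λ⁴-low (suc r) = record
  { at-[1] = begin
      multiplicity (gauss 4 (suc r)) 0            ≡⟨ below 0 refl refl ⟩
      Λ²-series a r (+ 1)                         ≡⟨ cong (count4ℕ 12 (suc r)) (shift (+ r) d) ⟩
      Λ²-series b′ r (+ 3 - + 6)                  ≡⟨ sym (Λ²-series-extend b′ r (+ 3 - + 6) _ tail) ⟩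
      Λ²-series b′ (suc r) (+ 3 - + 6)
        ≡⟨ cong (λ δ → Λ²-series (+ suc r - + 0 - + 4 - + (3 ℕ.* δ)) (suc r) (+ 3 - + 6)) (sym (δodd-suc r)) ⟩
      Λ²-series (top₂ (suc r) 0) (suc r) (+ 3 - + 6) ∎
  ; at-[2] = trans (below 1 refl refl) (Λ²-series-odd a r (+ 2) (a - + 3) (e₂ a))
  ; at-[3] = trans (below 2 refl refl) (trans (cong (λ c → Λ²-series c r (+ 3)) a≡)
                                    (Λ²-series-2mod4 (α + α) r (+ 3) (α - + 2) (e₃ α)))
  }
  where
  open ≡-Reasoning
  a = top₁ r 0
  α = proj₁ (top₁-even r)
  a≡ = proj₂ (top₁-even r)
  d = + (3 ℕ.* δeven r)
  b′ = + suc r - + 0 - + 4 - d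
  below : ∀ u → raise 4 (multiplicity (gauss 4 r)) u ≡ + 0 →
          raise 6 (λ v → Λ²-series (top₂ r 0) r (+ suc v)) u ≡ + 0 →
          multiplicity (gauss 4 (suc r)) u ≡ Λ²-series a r (+ suc u)
  below u R₄≡0 R₆≡0 = trans (Λ⁴-multiplicity-from-low r (Λ⁴-low r) u)
    (trans (cong₂ (λ p q → p + Λ²-series a r (+ suc u) + q) R₄≡0 R₆≡0) (e (Λ²-series a r (+ suc u))))
    where
    e : ∀ a → + 0 + a + + 0 ≡ a
    e = solve-∀
  shift : ∀ r d → (r - + 0 - + 1 - d) + (r - + 0 - + 1 - d) - + 3 - + 1
                  ≡ (+ 1 + r - + 0 - + 4 - d) + (+ 1 + r - + 0 - + 4 - d) - + 3 - (+ 3 - + 6)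
  shift = solve-∀
  e-tail : ∀ r d → (+ 1 + r - + 0 - + 4 - d) + (+ 1 + r - + 0 - + 4 - d) - + 3 - (+ 3 - + 6) - (+ 1 + r) * + 12
                   ≡ - (+ 1 + (+ 10 * r + + 17 + d + d))
  e-tail = solve-∀
  tail : b′ + b′ - + 3 - (+ 3 - + 6) - + suc r * + 12
         ≡ -[1+ (10 ℕ.* r ℕ.+ 17 ℕ.+ 3 ℕ.* δeven r ℕ.+ 3 ℕ.* δeven r) ]
  tail = trans (e-tail (+ r) d) (cong (λ p → - (+ 1 + (p + + 17 + d + d))) (sym (ℤP.pos-* 10 r)))
  e₂ : ∀ a → a + a - + 3 - + 2 ≡ (a - + 3) * + 2 + + 1
  e₂ = solve-∀
  e₃ : ∀ α → (α + α) + (α + α) - + 3 - + 3 ≡ (α - + 2) * + 4 + + 2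
  e₃ = solve-∀

Λ⁴-multiplicity : ∀ r u →
  multiplicity (gauss 4 (suc r)) u
    ≡ raise 4 (multiplicity (gauss 4 r)) u + Λ²-series (top₁ r 0) r (+ suc u)
      + raise 6 (λ v → Λ²-series (top₂ r 0) r (+ suc v)) u
Λ⁴-multiplicity r = Λ⁴-multiplicity-from-low r (Λ⁴-low r)

theorem1p3 : (r : ℕ) (m : ℤ) →
    qbin (+ suc r) 4 m ≡
      plus 4 (qbinW (+ r) 4) m
      + sumUpTo r (λ k → qbin (+ r - + (6 ℕ.* k) - + 1 - + (3 ℕ.* δeven r)) 2 m)
      + sumUpTo r (λ k → plus 6 (qbinW (+ r - + (6 ℕ.* k) - + 4 - + (3 ℕ.* δodd r)) 2) m)
theorem1p3 r = isVC-ext (isVC-qbin (+ suc r) 3) rhs-isVC same-multiplicities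
  where
  shifted first second : ℤ → ℤ
  shifted  = plus 4 (qbinW (+ r) 4)
  first m  = sumUpTo r (λ k → qbin (top₁ r k) 2 m)
  second m = sumUpTo r (λ k → plus 6 (qbinW (top₂ r k) 2) m)

  rhs-isVC : IsVirtualCharacter (λ m → shifted m + first m + second m)
  rhs-isVC = isVC-+ (isVC-+ (isVC-plus 4 (qbinW (+ r) 4))
                            (isVC-sum (λ k → qbin (top₁ r k) 2) (upTo (suc r)) (λ k → isVC-qbin (top₁ r k) 1)))
                    (isVC-sum (λ k → plus 6 (qbinW (top₂ r k) 2)) (upTo (suc r))
                              (λ k → isVC-plus 6 (qbinW (top₂ r k) 2)))

  ∂-shifted : multiplicity shifted ≗ raise 4 (multiplicity (gauss 4 r))
  ∂-shifted u = trans (∂-plus 4 (qbinW (+ r) 4) u) (raise-cong 4 (λ v → ∂-cong (qbin-+ r 3) (+ suc v)) u)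

  same-multiplicities : ∀ u →
    multiplicity (qbin (+ suc r) 4) u ≡ multiplicity (λ m → shifted m + first m + second m) u
  same-multiplicities u = begin
    multiplicity (qbin (+ suc r) 4) u      ≡⟨ ∂-cong (qbin-+ (suc r) 3) (+ suc u) ⟩
    multiplicity (gauss 4 (suc r)) u       ≡⟨ Λ⁴-multiplicity r u ⟩
    raise 4 (multiplicity (gauss 4 r)) u + Λ²-series (top₁ r 0) r (+ suc u)
      + raise 6 (λ v → Λ²-series (top₂ r 0) r (+ suc v)) u
      ≡⟨ sym (cong₂ _+_ (cong₂ _+_ (∂-shifted u) (∂-Λ²-series (top₁ r) r (top-progression r (+ 1) _) u))
                        (∂-plus-Λ²-series (top₂ r) r (top-progression r (+ 4) _) 6 u)) ⟩
    multiplicity shifted u + multiplicity first u + multiplicity second u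
      ≡⟨ sym (trans (∂-+ (λ m → shifted m + first m) second (+ suc u))
                    (cong (_+ multiplicity second u) (∂-+ shifted first (+ suc u)))) ⟩
    multiplicity (λ m → shifted m + first m + second m) u
      ∎
    where open ≡-Reasoning
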